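{- Let $b\in\{0,2,4,\ldots\}$ and let $k,m$ be positive integers with $m\ge 3$. Then $$E_{2^mk+b}\equiv E_b-2^mk\bigl((b+1)^2+10+2^mk(b+1)\bigr)\pmod{2^{m+6}}.$$
   Context: The Euler numbers $\{E_n\}_{n\ge 0}$ are defined by $E_0=1$, $E_{2n-1}=0$ and $\sum_{r=0}^{n}\binom{2n}{2r}E_{2r}=0$ for $n=1,2,3,\ldots$. -}

module Defs where

open import Data.Nat as ℕ using (ℕ; zero; suc)
open import Data.Nat.Combinatorics using (_C_)
open import Data.Integer as ℤ using (ℤ; +_; -_)
open import Data.List using (List; []; _∷_; _++_; foldr; zip; length; reverse)
open import Data.List using (upTo)
open import Data.Maybe using (fromMaybe)
open import Data.List using (head)

-- evenTable n = [E_0, E_2, ..., E_{2n}]  (in increasing order)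
-- using  E_{2n} = - Σ_{r=0}^{n-1} C(2n,2r) E_{2r}  for n ≥ 1,
-- which is the defining recurrence Σ_{r=0}^{n} C(2n,2r) E_{2r} = 0 solved for E_{2n}.
sumWith : ℕ → ℕ → List ℤ → ℤ
sumWith n r []       = + 0
sumWith n r (e ∷ es) = (+ (n C r)) ℤ.* e ℤ.+ sumWith n (suc (suc r)) es

evenTable : ℕ → List ℤ
evenTable zero    = + 1 ∷ []
evenTable (suc n) = evenTable n ++ (- sumWith (2 ℕ.* suc n) 0 (evenTable n) ∷ [])

Eeven : ℕ → ℤ
Eeven n = fromMaybe (+ 0) (head (reverse (evenTable n)))

-- Euler number E_n (E_n = 0 for odd n)
E : ℕ → ℤ
E zero          = + 1
E (suc zero)    = + 0
E (suc (suc n)) = Eeven (suc (n ℕ./ 2)) ℤ.* (+ (1 ℕ.∸ (n ℕ.% 2)))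

module Submission where

-- Let c q = Σ_j C(q,j) (-1)^(q-j) E j be the forward differences of E at 0, so that
-- E n = Σ_q C(n,q) c q.  Composing binomial transforms shows c (2n) = 0 for n ≥ 1
-- (the defining recurrence of E) and 2^n ∣ c (2n+1).  Hence
--   E (N + b) - E b = Σ_q D q · c q,    D q = C(N+b,q) - C(b,q).
-- Tail (q ≥ 10): if q < 2^(Λ+1) then 2^(m-Λ) ∣ D q, which together with the size of
-- c q (explicit for q ≤ 19, the general bound beyond) makes every term ≡ 0 mod 2^(m+6).
-- Head (q < 10): the head plus the correction term N((b+1)²+10+N(b+1)) is the member
-- H 0 b of a family H r b obeying H r (b+2) = H r b + H (r+1) b (Pascal's rule), and
-- H r b = 0 for r ≥ 9.  Induction on b reduces everything to b = 0, where 9!·H r 0 is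
-- an explicit integer polynomial in N whose coefficients are divisible by enough powers
-- of two; this is checked by evaluating a decidable certificate.

module EulerCongruence where

  open import Data.Nat as ℕ using (ℕ; zero; suc; z≤n; s≤s; _!)
  import Data.Nat.Properties as ℕP
  import Data.Nat.Tactic.RingSolver as ℕSolver
  open import Data.Nat.Combinatorics using (_C_; nCk+nC[k+1]≡[n+1]C[k+1]; k>n⇒nCk≡0; nCn≡1)
  open import Data.Integer as ℤ using (ℤ; +_; -_; _+_; _*_; _-_; _^_)
  import Data.Integer.Properties as ℤP
  open import Data.Integer.Tactic.RingSolver using (solve-∀)
  open import Data.Nat.DivMod using (m*n/n≡m; m/n*n≡m; [m+kn]%n≡m%n)
  open import Data.Nat.Divisibility using (m≤n⇒m!∣n!)
  open import Data.Nat.Induction using (<-rec)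
  open import Data.List using (List; []; _∷_; _++_; length; head)
  open import Data.List.Properties using (reverse-++; length-++)
  open import Data.Maybe using (fromMaybe)
  open import Data.Empty using (⊥-elim)
  open import Data.Fin using (Fin; toℕ; fromℕ<)
  open import Data.Fin.Properties using (toℕ-fromℕ<)
  open import Data.Fin.Patterns using (0F; 1F; 2F; 3F; 4F; 5F; 6F; 7F; 8F)
  open import Data.Product using (∃; _,_; _×_)
  open import Data.Unit using (⊤)
  open import Data.Sum using (_⊎_; inj₁; inj₂)
  open import Relation.Binary.PropositionalEquality
  open import Data.Integer.Divisibility.Signed
  import Data.Integer.Divisibility as Unsigned
  open import Relation.Nullary using (yes; no)
  open import Relation.Nullary.Decidable using (True; toWitness)
  open ≡-Reasoning
  open import Defs

  -- Binomial coefficients by Pascal's rule: Pascal's identity then holds by definition.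
  bin : ℕ → ℕ → ℕ
  bin zero    zero    = 1
  bin zero    (suc k) = 0
  bin (suc n) zero    = 1
  bin (suc n) (suc k) = bin n k ℕ.+ bin n (suc k)

  bin≡C : ∀ n k → bin n k ≡ n C k
  bin≡C zero    zero    = refl
  bin≡C zero    (suc k) = sym (k>n⇒nCk≡0 {0} {suc k} (s≤s z≤n))
  bin≡C (suc n) zero    = refl
  bin≡C (suc n) (suc k) =
    trans (cong₂ ℕ._+_ (bin≡C n k) (bin≡C n (suc k))) (nCk+nC[k+1]≡[n+1]C[k+1] n k)

  bin-n0 : ∀ n → bin n 0 ≡ 1
  bin-n0 zero    = refl
  bin-n0 (suc n) = refl

  bin-over : ∀ n k → n ℕ.< k → bin n k ≡ 0
  bin-over zero    (suc k) _         = refl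
  bin-over (suc n) (suc k) (s≤s n<k) =
    cong₂ ℕ._+_ (bin-over n k n<k) (bin-over n (suc k) (ℕP.m<n⇒m<1+n n<k))

  bin-nn : ∀ n → bin n n ≡ 1
  bin-nn zero    = refl
  bin-nn (suc n) = cong₂ ℕ._+_ (bin-nn n) (bin-over n (suc n) ℕP.≤-refl)

  absorb : ∀ y r → suc r ℕ.* bin (suc y) (suc r) ≡ suc y ℕ.* bin y r
  absorb zero    zero    = refl
  absorb zero    (suc r) =
    trans (cong (suc (suc r) ℕ.*_) (bin-over 0 (suc r) (s≤s z≤n))) (ℕP.*-zeroʳ (suc (suc r)))
  absorb (suc y) zero    =
    trans (ℕP.*-identityˡ _) (trans (bin-n1 (suc (suc y))) (sym (ℕP.*-identityʳ (suc (suc y)))))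
    where
    bin-n1 : ∀ n → bin n 1 ≡ n
    bin-n1 zero    = refl
    bin-n1 (suc n) = cong₂ ℕ._+_ (bin-n0 n) (bin-n1 n)
  absorb (suc y) (suc r) = begin
    suc (suc r) ℕ.* (bin (suc y) (suc r) ℕ.+ bin (suc y) (suc (suc r)))
      ≡⟨ ℕP.*-distribˡ-+ (suc (suc r)) (bin (suc y) (suc r)) _ ⟩
    suc (suc r) ℕ.* bin (suc y) (suc r) ℕ.+ suc (suc r) ℕ.* bin (suc y) (suc (suc r))
      ≡⟨ cong₂ ℕ._+_ (cong (bin (suc y) (suc r) ℕ.+_) (absorb y r)) (absorb y (suc r)) ⟩
    (bin (suc y) (suc r) ℕ.+ suc y ℕ.* bin y r) ℕ.+ suc y ℕ.* bin y (suc r)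
      ≡⟨ ℕP.+-assoc (bin (suc y) (suc r)) _ _ ⟩
    bin (suc y) (suc r) ℕ.+ (suc y ℕ.* bin y r ℕ.+ suc y ℕ.* bin y (suc r))
      ≡⟨ cong (bin (suc y) (suc r) ℕ.+_) (sym (ℕP.*-distribˡ-+ (suc y) (bin y r) (bin y (suc r)))) ⟩
    bin (suc y) (suc r) ℕ.+ suc y ℕ.* bin (suc y) (suc r) ∎

  sumℤ : (ℕ → ℤ) → ℕ → ℤ
  sumℤ f zero    = + 0
  sumℤ f (suc n) = sumℤ f n + f n

  sum-cong : ∀ {f g : ℕ → ℤ} n → (∀ q → q ℕ.< n → f q ≡ g q) → sumℤ f n ≡ sumℤ g n
  sum-cong zero    f≡g = refl
  sum-cong (suc n) f≡g =
    cong₂ _+_ (sum-cong n (λ q q<n → f≡g q (ℕP.m<n⇒m<1+n q<n))) (f≡g n ℕP.≤-refl)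

  sum-zero : ∀ (f : ℕ → ℤ) n → (∀ q → q ℕ.< n → f q ≡ + 0) → sumℤ f n ≡ + 0
  sum-zero f zero    f≡0 = refl
  sum-zero f (suc n) f≡0 =
    trans (cong₂ _+_ (sum-zero f n (λ q q<n → f≡0 q (ℕP.m<n⇒m<1+n q<n))) (f≡0 n ℕP.≤-refl)) refl

  sum-+ : ∀ (f g : ℕ → ℤ) n → sumℤ (λ q → f q + g q) n ≡ sumℤ f n + sumℤ g n
  sum-+ f g zero    = refl
  sum-+ f g (suc n) =
    trans (cong (_+ (f n + g n)) (sum-+ f g n)) (interchange (sumℤ f n) (sumℤ g n) (f n) (g n))
    where
    interchange : ∀ a b c d → (a + b) + (c + d) ≡ (a + c) + (b + d)
    interchange = solve-∀

  sum-sub : ∀ (f g : ℕ → ℤ) n → sumℤ (λ q → f q - g q) n ≡ sumℤ f n - sumℤ g n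
  sum-sub f g zero    = refl
  sum-sub f g (suc n) =
    trans (cong (_+ (f n - g n)) (sum-sub f g n)) (interchange (sumℤ f n) (sumℤ g n) (f n) (g n))
    where
    interchange : ∀ a b x y → (a - b) + (x - y) ≡ (a + x) - (b + y)
    interchange = solve-∀

  sum-* : ∀ (u : ℤ) (f : ℕ → ℤ) n → sumℤ (λ q → u * f q) n ≡ u * sumℤ f n
  sum-* u f zero    = sym (ℤP.*-zeroʳ u)
  sum-* u f (suc n) =
    trans (cong (_+ u * f n) (sum-* u f n)) (sym (ℤP.*-distribˡ-+ u (sumℤ f n) (f n)))

  sum-shift : ∀ (f : ℕ → ℤ) n → sumℤ f (suc n) ≡ f 0 + sumℤ (λ q → f (suc q)) n
  sum-shift f zero    = trans (ℤP.+-identityˡ (f 0)) (sym (ℤP.+-identityʳ (f 0)))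
  sum-shift f (suc n) = trans (cong (_+ f (suc n)) (sum-shift f n)) (ℤP.+-assoc (f 0) _ _)

  sum-split : ∀ (f : ℕ → ℤ) a v → sumℤ f (a ℕ.+ v) ≡ sumℤ f a + sumℤ (λ q → f (a ℕ.+ q)) v
  sum-split f a zero    = trans (cong (sumℤ f) (ℕP.+-identityʳ a)) (sym (ℤP.+-identityʳ _))
  sum-split f a (suc v) = begin
    sumℤ f (a ℕ.+ suc v)                                   ≡⟨ cong (sumℤ f) (ℕP.+-suc a v) ⟩
    sumℤ f (a ℕ.+ v) + f (a ℕ.+ v)                         ≡⟨ cong (_+ f (a ℕ.+ v)) (sum-split f a v) ⟩
    (sumℤ f a + sumℤ (λ q → f (a ℕ.+ q)) v) + f (a ℕ.+ v)  ≡⟨ ℤP.+-assoc (sumℤ f a) _ _ ⟩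
    sumℤ f a + sumℤ (λ q → f (a ℕ.+ q)) (suc v)            ∎

  sum-extend : ∀ (f : ℕ → ℤ) n k → (∀ q → n ℕ.≤ q → f q ≡ + 0) → sumℤ f (n ℕ.+ k) ≡ sumℤ f n
  sum-extend f n k f≡0 = begin
    sumℤ f (n ℕ.+ k)
      ≡⟨ sum-split f n k ⟩
    sumℤ f n + sumℤ (λ q → f (n ℕ.+ q)) k
      ≡⟨ cong (_+_ (sumℤ f n)) (sum-zero _ k (λ q _ → f≡0 (n ℕ.+ q) (ℕP.m≤m+n n q))) ⟩
    sumℤ f n + + 0
      ≡⟨ ℤP.+-identityʳ _ ⟩
    sumℤ f n ∎

  sum-even-odd : ∀ (f : ℕ → ℤ) n →
    sumℤ f (suc (2 ℕ.* n)) ≡ sumℤ (λ i → f (2 ℕ.* i)) (suc n) + sumℤ (λ i → f (suc (2 ℕ.* i))) n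
  sum-even-odd f zero    = sym (ℤP.+-identityʳ _)
  sum-even-odd f (suc n) = begin
    sumℤ f (suc (2 ℕ.* suc n))
      ≡⟨ cong (λ z → sumℤ f (suc z)) (ℕP.*-suc 2 n) ⟩
    (sumℤ f (suc (2 ℕ.* n)) + f (suc (2 ℕ.* n))) + f (2 ℕ.+ 2 ℕ.* n)
      ≡⟨ cong (λ z → (z + f (suc (2 ℕ.* n))) + f (2 ℕ.+ 2 ℕ.* n)) (sum-even-odd f n) ⟩
    ((evens + odds) + f (suc (2 ℕ.* n))) + f (2 ℕ.+ 2 ℕ.* n)
      ≡⟨ regroup evens odds _ _ ⟩
    (evens + f (2 ℕ.+ 2 ℕ.* n)) + (odds + f (suc (2 ℕ.* n)))
      ≡⟨ cong (λ z → (evens + f z) + (odds + f (suc (2 ℕ.* n)))) (sym (ℕP.*-suc 2 n)) ⟩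
    (evens + f (2 ℕ.* suc n)) + (odds + f (suc (2 ℕ.* n))) ∎
    where
    evens = sumℤ (λ i → f (2 ℕ.* i)) (suc n)
    odds  = sumℤ (λ i → f (suc (2 ℕ.* i))) n
    regroup : ∀ a b c d → ((a + b) + c) + d ≡ (a + d) + (b + c)
    regroup = solve-∀

  B : ℤ → (ℕ → ℤ) → ℕ → ℤ
  B x a p = sumℤ (λ q → + bin p q * (x ^ (p ℕ.∸ q) * a q)) (suc p)

  B-zero : ∀ x a → B x a 0 ≡ a 0
  B-zero x a = simplify (a 0)
    where
    simplify : ∀ z → + 0 + + 1 * (+ 1 * z) ≡ z
    simplify = solve-∀

  B-cong : ∀ x {a b : ℕ → ℤ} p → (∀ q → a q ≡ b q) → B x a p ≡ B x b p
  B-cong x p a≡b = sum-cong (suc p) (λ q _ → cong (λ z → + bin p q * (x ^ (p ℕ.∸ q) * z)) (a≡b q))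

  B-linear : ∀ x u (f g : ℕ → ℤ) p → B x (λ q → u * f q + g q) p ≡ u * B x f p + B x g p
  B-linear x u f g p = begin
    B x (λ q → u * f q + g q) p
      ≡⟨ sum-cong (suc p) (λ q _ → distribute (+ bin p q) (x ^ (p ℕ.∸ q)) u (f q) (g q)) ⟩
    sumℤ (λ q → u * (+ bin p q * (x ^ (p ℕ.∸ q) * f q)) + + bin p q * (x ^ (p ℕ.∸ q) * g q)) (suc p)
      ≡⟨ sum-+ _ _ (suc p) ⟩
    sumℤ (λ q → u * (+ bin p q * (x ^ (p ℕ.∸ q) * f q))) (suc p) + B x g p
      ≡⟨ cong (_+ B x g p) (sum-* u _ (suc p)) ⟩
    u * B x f p + B x g p ∎
    where
    distribute : ∀ b w u f g → b * (w * (u * f + g)) ≡ u * (b * (w * f)) + b * (w * g)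
    distribute = solve-∀

  B-step : ∀ x a p → B x a (suc p) ≡ x * B x a p + B x (λ q → a (suc q)) p
  B-step x a p = begin
    B x a (suc p)
      ≡⟨ sum-shift _ (suc p) ⟩
    first (x ^ suc p) + sumℤ (λ q → + bin (suc p) (suc q) * (x ^ (p ℕ.∸ q) * a (suc q))) (suc p)
      ≡⟨ cong (_+_ (first (x ^ suc p))) (trans (sum-cong (suc p) (λ q _ → pascal q)) (sum-+ G _ (suc p))) ⟩
    first (x ^ suc p) + (sumℤ G (suc p) + B x (λ q → a (suc q)) p)
      ≡⟨ cong (λ z → first (x ^ suc p) + (z + B x (λ q → a (suc q)) p)) G-sum ⟩
    first (x ^ suc p) + (x * sumℤ H p + B x (λ q → a (suc q)) p)
      ≡⟨ factor (x ^ p) x (a 0) (sumℤ H p) _ ⟩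
    x * (first (x ^ p) + sumℤ H p) + B x (λ q → a (suc q)) p
      ≡⟨ cong (λ w → x * (+ w * (x ^ p * a 0) + sumℤ H p) + B x (λ q → a (suc q)) p) (sym (bin-n0 p)) ⟩
    x * (+ bin p 0 * (x ^ p * a 0) + sumℤ H p) + B x (λ q → a (suc q)) p
      ≡⟨ cong (λ z → x * z + B x (λ q → a (suc q)) p) (sym (sum-shift _ p)) ⟩
    x * B x a p + B x (λ q → a (suc q)) p ∎
    where
    first : ℤ → ℤ
    first w = + 1 * (w * a 0)
    G H : ℕ → ℤ
    G q = + bin p (suc q) * (x ^ (p ℕ.∸ q) * a (suc q))
    H q = + bin p (suc q) * (x ^ (p ℕ.∸ suc q) * a (suc q))
    pascal : ∀ q → + bin (suc p) (suc q) * (x ^ (p ℕ.∸ q) * a (suc q))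
                 ≡ G q + + bin p q * (x ^ (p ℕ.∸ q) * a (suc q))
    pascal q = trans (cong (_* (x ^ (p ℕ.∸ q) * a (suc q))) (ℤP.pos-+ (bin p q) (bin p (suc q))))
                     (swap (+ bin p q) (+ bin p (suc q)) _)
      where
      swap : ∀ m n w → (m + n) * w ≡ n * w + m * w
      swap = solve-∀
    factor : ∀ xp x a0 s t → + 1 * ((x * xp) * a0) + (x * s + t) ≡ x * (+ 1 * (xp * a0) + s) + t
    factor = solve-∀
    -- The last term of G vanishes (C(p,p+1) = 0) and the others carry one extra factor x.
    G-sum : sumℤ G (suc p) ≡ x * sumℤ H p
    G-sum = begin
      sumℤ G p + G p
        ≡⟨ cong (_+_ (sumℤ G p)) (trans (cong (λ z → + z * (x ^ (p ℕ.∸ p) * a (suc p))) (bin-over p (suc p) ℕP.≤-refl))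
                                     (ℤP.*-zeroˡ (x ^ (p ℕ.∸ p) * a (suc p)))) ⟩
      sumℤ G p + + 0
        ≡⟨ ℤP.+-identityʳ _ ⟩
      sumℤ G p
        ≡⟨ sum-cong p (λ q q<p → trans (cong (λ e → + bin p (suc q) * (x ^ e * a (suc q))) (ℕP.+-∸-assoc 1 q<p))
                                       (pull-x (+ bin p (suc q)) x (x ^ (p ℕ.∸ suc q)) (a (suc q)))) ⟩
      sumℤ (λ q → x * H q) p
        ≡⟨ sum-* x H p ⟩
      x * sumℤ H p ∎
      where
      pull-x : ∀ b x w z → b * ((x * w) * z) ≡ x * (b * (w * z))
      pull-x = solve-∀

  B-comp : ∀ x y a p → B x (B y a) p ≡ B (x + y) a p
  B-comp x y a zero    = trans (B-zero x (B y a)) (trans (B-zero y a) (sym (B-zero (x + y) a)))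
  B-comp x y a (suc p) = begin
    B x (B y a) (suc p)
      ≡⟨ B-step x (B y a) p ⟩
    x * B x (B y a) p + B x (λ q → B y a (suc q)) p
      ≡⟨ cong (_+_ (x * B x (B y a) p)) (trans (B-cong x p (λ q → B-step y a q)) (B-linear x y (B y a) _ p)) ⟩
    x * B x (B y a) p + (y * B x (B y a) p + B x (B y a′) p)
      ≡⟨ cong₂ (λ u v → x * u + (y * u + v)) (B-comp x y a p) (B-comp x y a′ p) ⟩
    x * B (x + y) a p + (y * B (x + y) a p + B (x + y) a′ p)
      ≡⟨ collect x y (B (x + y) a p) _ ⟩
    (x + y) * B (x + y) a p + B (x + y) a′ p
      ≡⟨ sym (B-step (x + y) a p) ⟩
    B (x + y) a (suc p) ∎
    where
    a′ : ℕ → ℤ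
    a′ q = a (suc q)
    collect : ∀ x y u v → x * u + (y * u + v) ≡ (x + y) * u + v
    collect = solve-∀

  B-id : ∀ a p → B (+ 0) a p ≡ a p
  B-id a zero    = B-zero (+ 0) a
  B-id a (suc p) = trans (B-step (+ 0) a p) (trans (ℤP.+-identityˡ _) (B-id (λ q → a (suc q)) p))

  even-or-odd : ∀ s → ∃ λ i → (s ≡ 2 ℕ.* i) ⊎ (s ≡ suc (2 ℕ.* i))
  even-or-odd zero    = 0 , inj₁ refl
  even-or-odd (suc s) with even-or-odd s
  ... | i , inj₁ refl = i , inj₂ refl
  ... | i , inj₂ refl = suc i , inj₁ (sym (ℕP.*-suc 2 i))

  E-even : ∀ i → E (2 ℕ.* i) ≡ Eeven i
  E-even zero    = refl
  E-even (suc j) =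
    trans (cong E (ℕP.*-suc 2 j)) (trans (cong₂ (λ u v → Eeven (suc u) * + (1 ℕ.∸ v)) half parity) (ℤP.*-identityʳ _))
    where
    half : 2 ℕ.* j ℕ./ 2 ≡ j
    half = trans (cong (ℕ._/ 2) (ℕP.*-comm 2 j)) (m*n/n≡m j 2)
    parity : 2 ℕ.* j ℕ.% 2 ≡ 0
    parity = trans (cong (ℕ._% 2) (ℕP.*-comm 2 j)) ([m+kn]%n≡m%n 0 j 2)

  E-odd : ∀ i → E (suc (2 ℕ.* i)) ≡ + 0
  E-odd zero    = refl
  E-odd (suc j) = trans (cong (λ z → E (suc z)) (ℕP.*-suc 2 j)) (trans (cong (λ v → e * + (1 ℕ.∸ v)) parity) (ℤP.*-zeroʳ e))
    where
    e = Eeven (suc (suc (2 ℕ.* j) ℕ./ 2))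
    parity : suc (2 ℕ.* j) ℕ.% 2 ≡ 1
    parity = trans (cong (λ w → suc w ℕ.% 2) (ℕP.*-comm 2 j)) ([m+kn]%n≡m%n 1 j 2)

  sign-E : ∀ s → (- + 1) ^ s * E s ≡ E s
  sign-E s with even-or-odd s
  ... | i , inj₁ refl = trans (cong (_* E (2 ℕ.* i)) (trans (sym (ℤP.^-*-assoc (- + 1) 2 i)) (ℤP.^-zeroˡ i)))
                              (ℤP.*-identityˡ _)
  ... | i , inj₂ refl = trans (cong ((- + 1) ^ suc (2 ℕ.* i) *_) (E-odd i))
                              (trans (ℤP.*-zeroʳ ((- + 1) ^ suc (2 ℕ.* i))) (sym (E-odd i)))

  sumWith-++ : ∀ M r (xs ys : List ℤ) →
    sumWith M r (xs ++ ys) ≡ sumWith M r xs + sumWith M (2 ℕ.* length xs ℕ.+ r) ys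
  sumWith-++ M r []       ys = sym (ℤP.+-identityˡ _)
  sumWith-++ M r (x ∷ xs) ys = begin
    + (M C r) * x + sumWith M (2 ℕ.+ r) (xs ++ ys)
      ≡⟨ cong (_+_ (+ (M C r) * x)) (sumWith-++ M (2 ℕ.+ r) xs ys) ⟩
    + (M C r) * x + (sumWith M (2 ℕ.+ r) xs + sumWith M (2 ℕ.* length xs ℕ.+ (2 ℕ.+ r)) ys)
      ≡⟨ sym (ℤP.+-assoc (+ (M C r) * x) _ _) ⟩
    (+ (M C r) * x + sumWith M (2 ℕ.+ r) xs) + sumWith M (2 ℕ.* length xs ℕ.+ (2 ℕ.+ r)) ys
      ≡⟨ cong (λ k → (+ (M C r) * x + sumWith M (2 ℕ.+ r) xs) + sumWith M k ys) (index (length xs) r) ⟩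
    (+ (M C r) * x + sumWith M (2 ℕ.+ r) xs) + sumWith M (2 ℕ.* suc (length xs) ℕ.+ r) ys ∎
    where
    index : ∀ l r → 2 ℕ.* l ℕ.+ (2 ℕ.+ r) ≡ 2 ℕ.* suc l ℕ.+ r
    index = ℕSolver.solve-∀

  length-evenTable : ∀ n → length (evenTable n) ≡ suc n
  length-evenTable zero    = refl
  length-evenTable (suc n) =
    trans (length-++ (evenTable n)) (trans (cong (ℕ._+ 1) (length-evenTable n)) (ℕP.+-comm (suc n) 1))

  Eeven-suc : ∀ n → Eeven (suc n) ≡ - sumWith (2 ℕ.* suc n) 0 (evenTable n)
  Eeven-suc n = cong (λ l → fromMaybe (+ 0) (head l)) (reverse-++ (evenTable n) (_ ∷ []))

  sumWith-evenTable : ∀ M n → sumWith M 0 (evenTable n) ≡ sumℤ (λ i → + (M C (2 ℕ.* i)) * Eeven i) (suc n)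
  sumWith-evenTable M zero    = simplify (+ (M C 0))
    where
    simplify : ∀ c → c * + 1 + + 0 ≡ + 0 + c * + 1
    simplify = solve-∀
  sumWith-evenTable M (suc n) = begin
    sumWith M 0 (evenTable n ++ (x ∷ []))
      ≡⟨ sumWith-++ M 0 (evenTable n) (x ∷ []) ⟩
    sumWith M 0 (evenTable n) + sumWith M (2 ℕ.* length (evenTable n) ℕ.+ 0) (x ∷ [])
      ≡⟨ cong₂ _+_ (sumWith-evenTable M n)
                   (cong (λ k → sumWith M k (x ∷ [])) (trans (ℕP.+-identityʳ _) (cong (2 ℕ.*_) (length-evenTable n)))) ⟩
    sumℤ (λ i → + (M C (2 ℕ.* i)) * Eeven i) (suc n) + (+ (M C (2 ℕ.* suc n)) * x + + 0)
      ≡⟨ cong (_+_ (sumℤ (λ i → + (M C (2 ℕ.* i)) * Eeven i) (suc n)))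
              (trans (ℤP.+-identityʳ _) (cong (+ (M C (2 ℕ.* suc n)) *_) (sym (Eeven-suc n)))) ⟩
    sumℤ (λ i → + (M C (2 ℕ.* i)) * Eeven i) (suc (suc n)) ∎
    where
    x = - sumWith (2 ℕ.* suc n) 0 (evenTable n)

  Eeven-recurrence : ∀ n → sumℤ (λ i → + (2 ℕ.* suc n C (2 ℕ.* i)) * Eeven i) (suc (suc n)) ≡ + 0
  Eeven-recurrence n = begin
    S + + (M C M) * Eeven (suc n)
      ≡⟨ cong₂ (λ u v → S + + u * v) (nCn≡1 M) (trans (Eeven-suc n) (cong -_ (sumWith-evenTable M n))) ⟩
    S + + 1 * (- S)
      ≡⟨ cancel S ⟩
    + 0 ∎
    where
    M = 2 ℕ.* suc n
    S = sumℤ (λ i → + (M C (2 ℕ.* i)) * Eeven i) (suc n)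
    cancel : ∀ s → s + + 1 * (- s) ≡ + 0
    cancel = solve-∀

  E-recurrence : ∀ n → sumℤ (λ s → + bin (2 ℕ.* suc n) s * E s) (suc (2 ℕ.* suc n)) ≡ + 0
  E-recurrence n = begin
    sumℤ F (suc (2 ℕ.* suc n))
      ≡⟨ sum-even-odd F (suc n) ⟩
    sumℤ (λ i → F (2 ℕ.* i)) (suc (suc n)) + sumℤ (λ i → F (suc (2 ℕ.* i))) (suc n)
      ≡⟨ cong₂ _+_ (sum-cong (suc (suc n)) (λ i _ → cong₂ (λ u v → + u * v) (bin≡C M (2 ℕ.* i)) (E-even i)))
                   (sum-zero _ (suc n) (λ i _ → trans (cong (+ bin M (suc (2 ℕ.* i)) *_) (E-odd i))
                                                      (ℤP.*-zeroʳ (+ bin M (suc (2 ℕ.* i)))))) ⟩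
    sumℤ (λ i → + (M C (2 ℕ.* i)) * Eeven i) (suc (suc n)) + + 0
      ≡⟨ trans (ℤP.+-identityʳ _) (Eeven-recurrence n) ⟩
    + 0 ∎
    where
    M = 2 ℕ.* suc n
    F : ℕ → ℤ
    F s = + bin M s * E s

  -- The difference sequence c q = Σ_j C(q,j) (-1)^(q-j) E j and the binomial sums
  -- A p = Σ_j C(p,j) E j.  Since B 1 ∘ B (-1) = B 0 = id, E is recovered from c.
  c : ℕ → ℤ
  c = B (- + 1) E

  A : ℕ → ℤ
  A = B (+ 1) E

  E-from-c : ∀ n → E n ≡ B (+ 1) c n
  E-from-c n = sym (trans (B-comp (+ 1) (- + 1) E n) (B-id E n))

  B2c≡A : ∀ p → B (+ 2) c p ≡ A p
  B2c≡A p = B-comp (+ 2) (- + 1) E p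

  -- Because (-1)^j E j = E j, the two transforms differ by a global sign.
  c≡±A : ∀ p → c p ≡ (- + 1) ^ p * A p
  c≡±A p = trans (sum-cong (suc p) (λ q q<1+p → term q (ℕP.≤-pred q<1+p)))
                 (sum-* ((- + 1) ^ p) (λ q → + bin p q * ((+ 1) ^ (p ℕ.∸ q) * E q)) (suc p))
    where
    term : ∀ q → q ℕ.≤ p →
      + bin p q * ((- + 1) ^ (p ℕ.∸ q) * E q) ≡ (- + 1) ^ p * (+ bin p q * ((+ 1) ^ (p ℕ.∸ q) * E q))
    term q q≤p = begin
      + bin p q * ((- + 1) ^ (p ℕ.∸ q) * E q)
        ≡⟨ cong (λ z → + bin p q * ((- + 1) ^ (p ℕ.∸ q) * z)) (sym (sign-E q)) ⟩
      + bin p q * ((- + 1) ^ (p ℕ.∸ q) * ((- + 1) ^ q * E q))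
        ≡⟨ cong (+ bin p q *_) (sym (ℤP.*-assoc ((- + 1) ^ (p ℕ.∸ q)) _ _)) ⟩
      + bin p q * (((- + 1) ^ (p ℕ.∸ q) * (- + 1) ^ q) * E q)
        ≡⟨ cong (λ z → + bin p q * (z * E q)) (sym (ℤP.^-distribˡ-+-* (- + 1) (p ℕ.∸ q) q)) ⟩
      + bin p q * ((- + 1) ^ (p ℕ.∸ q ℕ.+ q) * E q)
        ≡⟨ cong (λ e → + bin p q * ((- + 1) ^ e * E q)) (ℕP.m∸n+n≡m q≤p) ⟩
      + bin p q * ((- + 1) ^ p * E q)
        ≡⟨ reorder (+ bin p q) ((- + 1) ^ p) (E q) ⟩
      (- + 1) ^ p * (+ bin p q * (+ 1 * E q))
        ≡⟨ cong (λ z → (- + 1) ^ p * (+ bin p q * (z * E q))) (sym (ℤP.^-zeroˡ (p ℕ.∸ q))) ⟩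
      (- + 1) ^ p * (+ bin p q * ((+ 1) ^ (p ℕ.∸ q) * E q)) ∎
      where
      reorder : ∀ b s e → b * (s * e) ≡ s * (b * (+ 1 * e))
      reorder = solve-∀

  -- The Euler recurrence says A vanishes at even positive indices, hence so does c.
  A-even : ∀ n → A (2 ℕ.* suc n) ≡ + 0
  A-even n = trans (sum-cong (suc M) (λ q _ → cong (+ bin M q *_) (drop-one q))) (E-recurrence n)
    where
    M = 2 ℕ.* suc n
    drop-one : ∀ q → (+ 1) ^ (M ℕ.∸ q) * E q ≡ E q
    drop-one q = trans (cong (_* E q) (ℤP.^-zeroˡ (M ℕ.∸ q))) (ℤP.*-identityˡ (E q))

  c-even : ∀ n → c (2 ℕ.* suc n) ≡ + 0
  c-even n = trans (c≡±A (2 ℕ.* suc n))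
                   (trans (cong ((- + 1) ^ (2 ℕ.* suc n) *_) (A-even n)) (ℤP.*-zeroʳ ((- + 1) ^ (2 ℕ.* suc n))))

  B2c-odd : ∀ n → B (+ 2) c (suc (2 ℕ.* n)) ≡ - c (suc (2 ℕ.* n))
  B2c-odd n = begin
    B (+ 2) c p                          ≡⟨ B2c≡A p ⟩
    A p                                  ≡⟨ double-negation (A p) ⟩
    (- + 1) * ((- + 1) * A p)            ≡⟨ cong (λ z → - + 1 * (z * A p)) (sym odd-power) ⟩
    (- + 1) * ((- + 1) ^ p * A p)        ≡⟨ cong (- + 1 *_) (sym (c≡±A p)) ⟩
    (- + 1) * c p                        ≡⟨ ℤP.-1*i≡-i (c p) ⟩
    - c p                                ∎
    where
    p = suc (2 ℕ.* n)
    odd-power : (- + 1) ^ p ≡ - + 1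
    odd-power = cong (- + 1 *_) (trans (sym (ℤP.^-*-assoc (- + 1) 2 n)) (ℤP.^-zeroˡ n))
    double-negation : ∀ a → a ≡ (- + 1) * ((- + 1) * a)
    double-negation = solve-∀

  E-newton : ∀ n k → E n ≡ sumℤ (λ q → + bin n q * c q) (suc n ℕ.+ k)
  E-newton n k = begin
    E n
      ≡⟨ E-from-c n ⟩
    B (+ 1) c n
      ≡⟨ sum-cong (suc n) (λ q _ → cong (+ bin n q *_)
                                   (trans (cong (_* c q) (ℤP.^-zeroˡ (n ℕ.∸ q))) (ℤP.*-identityˡ (c q)))) ⟩
    sumℤ (λ q → + bin n q * c q) (suc n)
      ≡⟨ sym (sum-extend _ (suc n) k (λ q n<q → trans (cong (λ z → + z * c q) (bin-over n q n<q)) (ℤP.*-zeroˡ (c q)))) ⟩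
    sumℤ (λ q → + bin n q * c q) (suc n ℕ.+ k) ∎

  -- (r+1)·C(n,r+1) = (n-r)·C(n,r), read in ℤ so that it holds for all n and r.
  bin-falling : ∀ n r → + suc r * + bin n (suc r) ≡ (+ n - + r) * + bin n r
  bin-falling n       zero    = begin
    + 1 * + bin n 1           ≡⟨ ℤP.*-identityˡ _ ⟩
    + bin n 1                 ≡⟨ cong +_ (bin-n1 n) ⟩
    + n                       ≡⟨ sym (ℤP.*-identityʳ (+ n)) ⟩
    + n * + 1                 ≡⟨ cong₂ _*_ (sym (ℤP.+-identityʳ (+ n))) (cong +_ (sym (bin-n0 n))) ⟩
    (+ n - + 0) * + bin n 0   ∎
    where
    bin-n1 : ∀ n → bin n 1 ≡ n
    bin-n1 zero    = refl
    bin-n1 (suc n) = cong₂ ℕ._+_ (bin-n0 n) (bin-n1 n)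
  bin-falling zero    (suc r) = trans (ℤP.*-zeroʳ (+ suc (suc r))) (sym (ℤP.*-zeroʳ (+ 0 - + suc r)))
  bin-falling (suc y) (suc r) = begin
    (+ 1 + (+ 1 + + r)) * (+ b + + d)
      ≡⟨ expand (+ r) (+ b) (+ d) ⟩
    + b + (+ 1 + + r) * + b + (+ 1 + (+ 1 + + r)) * + d
      ≡⟨ cong₂ (λ u v → + b + u + v) (bin-falling y r) (bin-falling y (suc r)) ⟩
    + b + (+ y - + r) * + a + (+ y - (+ 1 + + r)) * + b
      ≡⟨ collect (+ y) (+ r) (+ a) (+ b) ⟩
    ((+ 1 + + y) - (+ 1 + + r)) * (+ a + + b) ∎
    where
    a = bin y r
    b = bin y (suc r)
    d = bin y (suc (suc r))
    expand : ∀ r b d → (+ 1 + (+ 1 + r)) * (b + d) ≡ b + (+ 1 + r) * b + (+ 1 + (+ 1 + r)) * d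
    expand = solve-∀
    collect : ∀ y r a b → b + (y - r) * a + (y - (+ 1 + r)) * b ≡ ((+ 1 + y) - (+ 1 + r)) * (a + b)
    collect = solve-∀

  -- Integer polynomials as coefficient lists (constant term first), evaluated by Horner's rule.
  Poly : Set
  Poly = List ℤ

  ⟦_⟧ : Poly → ℤ → ℤ
  ⟦ []    ⟧ x = + 0
  ⟦ a ∷ p ⟧ x = a + x * ⟦ p ⟧ x

  infixl 6 _+ₚ_
  infixr 7 _·ₚ_

  _+ₚ_ : Poly → Poly → Poly
  []      +ₚ q       = q
  (a ∷ p) +ₚ []      = a ∷ p
  (a ∷ p) +ₚ (b ∷ q) = (a + b) ∷ (p +ₚ q)

  _·ₚ_ : ℤ → Poly → Poly
  u ·ₚ []      = []
  u ·ₚ (a ∷ p) = u * a ∷ u ·ₚ p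

  +ₚ-correct : ∀ p q x → ⟦ p +ₚ q ⟧ x ≡ ⟦ p ⟧ x + ⟦ q ⟧ x
  +ₚ-correct []      q       x = sym (ℤP.+-identityˡ _)
  +ₚ-correct (a ∷ p) []      x = sym (ℤP.+-identityʳ _)
  +ₚ-correct (a ∷ p) (b ∷ q) x =
    trans (cong (λ z → (a + b) + x * z) (+ₚ-correct p q x)) (regroup a b x (⟦ p ⟧ x) (⟦ q ⟧ x))
    where
    regroup : ∀ a b x P Q → (a + b) + x * (P + Q) ≡ (a + x * P) + (b + x * Q)
    regroup = solve-∀

  ·ₚ-correct : ∀ u p x → ⟦ u ·ₚ p ⟧ x ≡ u * ⟦ p ⟧ x
  ·ₚ-correct u []      x = sym (ℤP.*-zeroʳ u)
  ·ₚ-correct u (a ∷ p) x = trans (cong (λ z → u * a + x * z) (·ₚ-correct u p x)) (factor u a x (⟦ p ⟧ x))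
    where
    factor : ∀ u a x P → u * a + x * (u * P) ≡ u * (a + x * P)
    factor = solve-∀

  sumₚ : (ℕ → Poly) → ℕ → Poly
  sumₚ f zero    = []
  sumₚ f (suc n) = sumₚ f n +ₚ f n

  sumₚ-correct : ∀ f n x → ⟦ sumₚ f n ⟧ x ≡ sumℤ (λ p → ⟦ f p ⟧ x) n
  sumₚ-correct f zero    x = refl
  sumₚ-correct f (suc n) x = trans (+ₚ-correct (sumₚ f n) (f n) x) (cong (_+ ⟦ f n ⟧ x) (sumₚ-correct f n x))

  falling : ℕ → Poly
  falling zero    = + 1 ∷ []
  falling (suc r) = (+ 0 ∷ falling r) +ₚ (- + r) ·ₚ falling r

  falling-bin : ∀ r N → ⟦ falling r ⟧ (+ N) ≡ + (r !) * + bin N r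
  falling-bin zero    N = trans (cong (_+_ (+ 1)) (ℤP.*-zeroʳ (+ N))) (cong (λ z → + 1 * + z) (sym (bin-n0 N)))
  falling-bin (suc r) N = begin
    ⟦ (+ 0 ∷ falling r) +ₚ (- + r) ·ₚ falling r ⟧ (+ N)
      ≡⟨ +ₚ-correct (+ 0 ∷ falling r) ((- + r) ·ₚ falling r) (+ N) ⟩
    (+ 0 + + N * ⟦ falling r ⟧ (+ N)) + ⟦ (- + r) ·ₚ falling r ⟧ (+ N)
      ≡⟨ cong₂ (λ u v → (+ 0 + + N * u) + v) (falling-bin r N) (·ₚ-correct (- + r) (falling r) (+ N)) ⟩
    (+ 0 + + N * (+ (r !) * + bin N r)) + (- + r) * ⟦ falling r ⟧ (+ N)
      ≡⟨ cong (λ z → (+ 0 + + N * (+ (r !) * + bin N r)) + (- + r) * z) (falling-bin r N) ⟩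
    (+ 0 + + N * (+ (r !) * + bin N r)) + (- + r) * (+ (r !) * + bin N r)
      ≡⟨ factor (+ N) (+ r) (+ (r !)) (+ bin N r) ⟩
    + (r !) * ((+ N - + r) * + bin N r)
      ≡⟨ cong (+ (r !) *_) (sym (bin-falling N r)) ⟩
    + (r !) * (+ suc r * + bin N (suc r))
      ≡⟨ reassociate (+ (r !)) (+ suc r) (+ bin N (suc r)) ⟩
    + suc r * + (r !) * + bin N (suc r)
      ≡⟨ cong (_* + bin N (suc r)) (sym (ℤP.pos-* (suc r) (r !))) ⟩
    + (suc r !) * + bin N (suc r) ∎
    where
    factor : ∀ n r f b → (+ 0 + n * (f * b)) + (- r) * (f * b) ≡ f * ((n - r) * b)
    factor = solve-∀
    reassociate : ∀ f s b → f * (s * b) ≡ s * f * b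
    reassociate = solve-∀

  pow2 : ℕ → ℤ
  pow2 e = (+ 2) ^ e

  pow2-+ : ∀ a b → pow2 (a ℕ.+ b) ≡ pow2 a * pow2 b
  pow2-+ = ℤP.^-distribˡ-+-* (+ 2)

  pow2-mono : ∀ {a b} → a ℕ.≤ b → pow2 a ∣ pow2 b
  pow2-mono {a} {b} a≤b = divides (pow2 (b ℕ.∸ a))
    (trans (cong pow2 (sym (ℕP.m∸n+n≡m a≤b))) (pow2-+ (b ℕ.∸ a) a))

  pos-pow2 : ∀ e → + (2 ℕ.^ e) ≡ pow2 e
  pos-pow2 zero    = refl
  pos-pow2 (suc e) = trans (ℤP.pos-* 2 (2 ℕ.^ e)) (cong (+ 2 *_) (pos-pow2 e))

  ∣0 : ∀ d → d ∣ + 0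
  ∣0 d = divides (+ 0) refl

  ∣-* : ∀ {a b x y} → a ∣ x → b ∣ y → a * b ∣ x * y
  ∣-* {a} {b} (divides p refl) (divides q refl) = divides (p * q) (interchange p a q b)
    where
    interchange : ∀ p a q b → (p * a) * (q * b) ≡ (p * q) * (a * b)
    interchange = solve-∀

  pow2-∣-* : ∀ a e {s x y} → pow2 a ∣ x → pow2 e ∣ y → s ℕ.≤ a ℕ.+ e → pow2 s ∣ x * y
  pow2-∣-* a e {s} {x} {y} ∣x ∣y s≤a+e =
    ∣-trans (pow2-mono s≤a+e) (subst (_∣ x * y) (sym (pow2-+ a e)) (∣-* ∣x ∣y))

  sum-div : ∀ d (f : ℕ → ℤ) n → (∀ q → q ℕ.< n → d ∣ f q) → d ∣ sumℤ f n
  sum-div d f zero    d∣f = ∣0 d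
  sum-div d f (suc n) d∣f =
    ∣m∣n⇒∣m+n (sum-div d f n (λ q q<n → d∣f q (ℕP.m<n⇒m<1+n q<n))) (d∣f n ℕP.≤-refl)

  two∣odd*X⇒two∣X : ∀ o X → + 2 ∣ (+ 1 + + 2 * o) * X → + 2 ∣ X
  two∣odd*X⇒two∣X o X 2∣oX = ∣m+n∣n⇒∣m (subst (+ 2 ∣_) (split o X) 2∣oX) (∣m⇒∣m*n (o * X) ∣-refl)
    where
    split : ∀ o X → (+ 1 + + 2 * o) * X ≡ X + + 2 * (o * X)
    split = solve-∀

  odd-cancel : ∀ e o X → pow2 e ∣ (+ 1 + + 2 * o) * X → pow2 e ∣ X
  odd-cancel zero    o X _ = divides X (sym (ℤP.*-identityʳ X))
  odd-cancel (suc e) o X h with two∣odd*X⇒two∣X o X (∣-trans (∣m⇒∣m*n (pow2 e) ∣-refl) h)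
  ... | divides X′ refl =
    subst (pow2 (suc e) ∣_) (ℤP.*-comm (+ 2) X′)
          (*-monoʳ-∣ (+ 2) (odd-cancel e o X′ (*-cancelˡ-∣ (+ 2) (subst (pow2 (suc e) ∣_) (pull-2 o X′) h))))
    where
    pull-2 : ∀ o X → (+ 1 + + 2 * o) * (X * + 2) ≡ + 2 * ((+ 1 + + 2 * o) * X)
    pull-2 = solve-∀

  -- Expanding B 2 c p = -c p
  -- for p = 2n+1 gives 2·c p = -Σ_{q<p} C(p,q) 2^(p-q) c q, and every term on the right
  -- is divisible by 2^(n+1): even q > 0 contribute nothing, odd q = 2i+1 < p contribute
  -- 2^(p-q) · 2^i with p - q + i ≥ n + 1.
  c-odd-step : ∀ n → (∀ {i} → i ℕ.< n → pow2 i ∣ c (suc (2 ℕ.* i))) → pow2 n ∣ c (suc (2 ℕ.* n))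
  c-odd-step n IH = *-cancelˡ-∣ (+ 2) (subst (pow2 (suc n) ∣_) twice-c (∣m⇒∣-m (sum-div _ g p term-div)))
    where
    p = suc (2 ℕ.* n)
    g : ℕ → ℤ
    g q = + bin p q * ((+ 2) ^ (p ℕ.∸ q) * c q)
    R = sumℤ g p
    last-term : + bin p p * ((+ 2) ^ (p ℕ.∸ p) * c p) ≡ c p
    last-term = trans (cong₂ (λ b e → + b * ((+ 2) ^ e * c p)) (bin-nn p) (ℕP.n∸n≡0 p)) (drop-ones (c p))
      where
      drop-ones : ∀ z → + 1 * (+ 1 * z) ≡ z
      drop-ones = solve-∀
    twice-c : - R ≡ + 2 * c p
    twice-c = begin
      - R                   ≡⟨ rearrange R (c p) ⟩
      - (R + c p) + c p     ≡⟨ cong (λ z → - (R + z) + c p) (sym last-term) ⟩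
      - B (+ 2) c p + c p   ≡⟨ cong (λ z → - z + c p) (B2c-odd n) ⟩
      - - c p + c p         ≡⟨ double (c p) ⟩
      + 2 * c p             ∎
      where
      rearrange : ∀ r x → - r ≡ - (r + x) + x
      rearrange = solve-∀
      double : ∀ x → - - x + x ≡ + 2 * x
      double = solve-∀
    term-div : ∀ q → q ℕ.< p → pow2 (suc n) ∣ g q
    term-div q q<p with even-or-odd q
    ... | zero  , inj₁ refl =
      ∣n⇒∣m*n (+ bin p 0) (∣m⇒∣m*n (c 0) (pow2-mono (s≤s (ℕP.m≤m+n n (n ℕ.+ 0)))))
    ... | suc i , inj₁ refl =
      subst (pow2 (suc n) ∣_) (sym (trans (cong (λ z → + bin p q * ((+ 2) ^ (p ℕ.∸ q) * z)) (c-even i))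
                                          (vanish (+ bin p q) ((+ 2) ^ (p ℕ.∸ q)))))
            (∣0 (pow2 (suc n)))
      where
      vanish : ∀ a b → a * (b * + 0) ≡ + 0
      vanish = solve-∀
    ... | i , inj₂ refl = ∣n⇒∣m*n (+ bin p q) (pow2-∣-* (p ℕ.∸ q) i ∣-refl (IH i<n) exponent)
      where
      i<n : i ℕ.< n
      i<n = ℕP.*-cancelˡ-< 2 i n (ℕP.≤-pred q<p)
      exponent : suc n ℕ.≤ (p ℕ.∸ q) ℕ.+ i
      exponent = subst (λ n → suc n ℕ.≤ (suc (2 ℕ.* n) ℕ.∸ suc (2 ℕ.* i)) ℕ.+ i)
                       (ℕP.m+[n∸m]≡n i<n) (gap i (n ℕ.∸ suc i))
        where
        gap : ∀ i d → suc (suc i ℕ.+ d) ℕ.≤ (suc (2 ℕ.* (suc i ℕ.+ d)) ℕ.∸ suc (2 ℕ.* i)) ℕ.+ i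
        gap i d = ℕP.≤-trans (ℕP.m≤m+n (suc (suc i ℕ.+ d)) d) (ℕP.≤-reflexive (sym difference))
          where
          difference : (suc (2 ℕ.* (suc i ℕ.+ d)) ℕ.∸ suc (2 ℕ.* i)) ℕ.+ i ≡ suc (suc i ℕ.+ d) ℕ.+ d
          difference = trans (cong (λ z → (z ℕ.∸ 2 ℕ.* i) ℕ.+ i) (double i d))
                             (trans (cong (ℕ._+ i) (ℕP.m+n∸m≡n (2 ℕ.* i) _)) (regroup i d))
            where
            double : ∀ i d → 2 ℕ.* (suc i ℕ.+ d) ≡ 2 ℕ.* i ℕ.+ (2 ℕ.+ 2 ℕ.* d)
            double = ℕSolver.solve-∀
            regroup : ∀ i d → (2 ℕ.+ 2 ℕ.* d) ℕ.+ i ≡ suc (suc i ℕ.+ d) ℕ.+ d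
            regroup = ℕSolver.solve-∀

  c-odd-div : ∀ n → pow2 n ∣ c (suc (2 ℕ.* n))
  c-odd-div = <-rec (λ n → pow2 n ∣ c (suc (2 ℕ.* n))) c-odd-step

  -- If 2^m ∣ N then 2^m ∣ p·C(N,p), since p·C(N,p) = N·C(N-1,p-1).
  multiple-bin : ∀ m N p → pow2 m ∣ + N → pow2 m ∣ + p * + bin N p
  multiple-bin m N       zero    _   = ∣0 (pow2 m)
  multiple-bin m zero    (suc r) _   = subst (pow2 m ∣_) (sym (ℤP.*-zeroʳ (+ suc r))) (∣0 (pow2 m))
  multiple-bin m (suc y) (suc r) 2^m∣N = subst (pow2 m ∣_) absorption (∣m⇒∣m*n (+ bin y r) 2^m∣N)
    where
    absorption : + suc y * + bin y r ≡ + suc r * + bin (suc y) (suc r)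
    absorption = trans (sym (ℤP.pos-* (suc y) (bin y r)))
                       (trans (cong +_ (sym (absorb y r))) (ℤP.pos-* (suc r) (bin (suc y) (suc r))))

  -- If 1 ≤ p < 2^(Λ+1) then p = 2^a·(odd) with a ≤ Λ, so 2^m ∣ p·X gives 2^(m-Λ) ∣ X.
  -- Odd p are cancelled at once; for even p one factor 2 is removed and Λ decreases.
  cancel-small : ∀ Λ m p X → 1 ℕ.≤ p → p ℕ.< 2 ℕ.^ suc Λ → pow2 m ∣ + p * X → pow2 (m ℕ.∸ Λ) ∣ X
  cancel-even  : ∀ Λ m j X → 1 ℕ.≤ 2 ℕ.* j → 2 ℕ.* j ℕ.< 2 ℕ.^ suc Λ → pow2 m ∣ + (2 ℕ.* j) * X →
                 pow2 (m ℕ.∸ Λ) ∣ X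

  cancel-small Λ m p X 1≤p p<2^Λ+1 h with even-or-odd p
  ... | j , inj₁ refl = cancel-even Λ m j X 1≤p p<2^Λ+1 h
  ... | j , inj₂ refl =
    ∣-trans (pow2-mono (ℕP.m∸n≤m m Λ)) (odd-cancel m (+ j) X (subst (pow2 m ∣_) odd-factor h))
    where
    odd-factor : + suc (2 ℕ.* j) * X ≡ (+ 1 + + 2 * + j) * X
    odd-factor = cong (λ z → (+ 1 + z) * X) (ℤP.pos-* 2 j)

  cancel-even zero    m       j X 1≤2j 2j<2 h =
    ⊥-elim (ℕP.<-irrefl refl (ℕP.<-≤-trans 1≤2j (ℕP.*-monoʳ-≤ 2 (ℕP.≤-pred (ℕP.*-cancelˡ-< 2 j 1 2j<2)))))
  cancel-even (suc Λ) zero    j X _    _       h = divides X (sym (ℤP.*-identityʳ X))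
  cancel-even (suc Λ) (suc m) j X 1≤2j 2j<2^Λ+2 h =
    cancel-small Λ m j X 1≤j (ℕP.*-cancelˡ-< 2 j (2 ℕ.^ suc Λ) 2j<2^Λ+2)
                 (*-cancelˡ-∣ (+ 2) (subst (pow2 (suc m) ∣_) pull-2 h))
    where
    1≤j : 1 ℕ.≤ j
    1≤j = ℕP.n≢0⇒n>0 (λ j≡0 → ℕP.<-irrefl refl (subst (λ j → 0 ℕ.< 2 ℕ.* j) j≡0 1≤2j))
    pull-2 : + (2 ℕ.* j) * X ≡ + 2 * (+ j * X)
    pull-2 = trans (cong (_* X) (ℤP.pos-* 2 j)) (ℤP.*-assoc (+ 2) (+ j) X)

  bin-of-multiple : ∀ m N Λ p → pow2 m ∣ + N → 1 ℕ.≤ p → p ℕ.< 2 ℕ.^ suc Λ → pow2 (m ℕ.∸ Λ) ∣ + bin N p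
  bin-of-multiple m N Λ p 2^m∣N 1≤p p<2^Λ+1 = cancel-small Λ m p (+ bin N p) 1≤p p<2^Λ+1 (multiple-bin m N p 2^m∣N)

  D : ℕ → ℕ → ℕ → ℤ
  D N b p = + bin (N ℕ.+ b) p - + bin b p

  D-zero : ∀ N b → D N b 0 ≡ + 0
  D-zero N b = cong₂ (λ x y → + x - + y) (bin-n0 (N ℕ.+ b)) (bin-n0 b)

  D-suc : ∀ N b p → D N (suc b) (suc p) ≡ D N b p + D N b (suc p)
  D-suc N b p = begin
    + bin (N ℕ.+ suc b) (suc p) - + bin (suc b) (suc p)
      ≡⟨ cong (λ z → + bin z (suc p) - + bin (suc b) (suc p)) (ℕP.+-suc N b) ⟩
    (+ bin (N ℕ.+ b) p + + bin (N ℕ.+ b) (suc p)) - (+ bin b p + + bin b (suc p))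
      ≡⟨ interchange (+ bin (N ℕ.+ b) p) (+ bin (N ℕ.+ b) (suc p)) (+ bin b p) (+ bin b (suc p)) ⟩
    D N b p + D N b (suc p) ∎
    where
    interchange : ∀ a b c d → (a + b) - (c + d) ≡ (a - c) + (b - d)
    interchange = solve-∀

  D-div : ∀ N d L → (∀ p → 1 ℕ.≤ p → p ℕ.< L → d ∣ + bin N p) → ∀ b p → p ℕ.< L → d ∣ D N b p
  D-div N d L d∣C b       zero    _   = subst (d ∣_) (sym (D-zero N b)) (∣0 d)
  D-div N d L d∣C zero    (suc p) p<L =
    subst (d ∣_) (sym (trans (ℤP.+-identityʳ _) (cong (λ z → + bin z (suc p)) (ℕP.+-identityʳ N))))
          (d∣C (suc p) (s≤s z≤n) p<L)
  D-div N d L d∣C (suc b) (suc p) p<L = subst (d ∣_) (sym (D-suc N b p))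
    (∣m∣n⇒∣m+n (D-div N d L d∣C b p (ℕP.<-trans (ℕP.n<1+n p) p<L)) (D-div N d L d∣C b (suc p) p<L))

  -- The tail.  For q ≥ 10 and 2^m ∣ N every term D N b q · c q is divisible by
  -- 2^(m+6): if 2^(Λ+6) ∣ c q and q < 2^(Λ+1) this follows from 2^(m-Λ) ∣ D N b q.
  module Tail (m N : ℕ) (2^m∣N : pow2 m ∣ + N) where

    term-div : ∀ b q Λ → pow2 (Λ ℕ.+ 6) ∣ c q → q ℕ.< 2 ℕ.^ suc Λ → pow2 (m ℕ.+ 6) ∣ D N b q * c q
    term-div b q Λ c-div q<2^Λ+1 = pow2-∣-* (m ℕ.∸ Λ) (Λ ℕ.+ 6) D-div-q c-div exponent
      where
      D-div-q : pow2 (m ℕ.∸ Λ) ∣ D N b q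
      D-div-q = D-div N (pow2 (m ℕ.∸ Λ)) (2 ℕ.^ suc Λ) (λ p → bin-of-multiple m N Λ p 2^m∣N) b q q<2^Λ+1
      exponent : m ℕ.+ 6 ℕ.≤ (m ℕ.∸ Λ) ℕ.+ (Λ ℕ.+ 6)
      exponent = ℕP.≤-trans (ℕP.+-monoˡ-≤ 6 (ℕP.m≤n+m∸n m Λ)) (ℕP.≤-reflexive (regroup Λ (m ℕ.∸ Λ)))
        where
        regroup : ∀ a b → (a ℕ.+ b) ℕ.+ 6 ≡ b ℕ.+ (a ℕ.+ 6)
        regroup = ℕSolver.solve-∀

    -- 2(10+j)+1 < 2^(5+j), so Λ = 4+j is available for the general bound 2^(10+j) ∣ c (2(10+j)+1).
    growth : ∀ j → suc (2 ℕ.* (10 ℕ.+ j)) ℕ.< 2 ℕ.^ (5 ℕ.+ j)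
    growth zero    = ℕP.<ᵇ⇒< 21 32 _
    growth (suc j) = ℕP.≤-trans (room j) (ℕP.*-monoʳ-≤ 2 (growth j))
      where
      room : ∀ j → suc (suc (2 ℕ.* (10 ℕ.+ suc j))) ℕ.≤ 2 ℕ.* suc (suc (2 ℕ.* (10 ℕ.+ j)))
      room j = ℕP.≤-trans (ℕP.m≤m+n _ (20 ℕ.+ 2 ℕ.* j)) (ℕP.≤-reflexive (double j))
        where
        double : ∀ j → suc (suc (2 ℕ.* (10 ℕ.+ suc j))) ℕ.+ (20 ℕ.+ 2 ℕ.* j) ≡ 2 ℕ.* suc (suc (2 ℕ.* (10 ℕ.+ j)))
        double = ℕSolver.solve-∀

    tail-term : ∀ b q → pow2 (m ℕ.+ 6) ∣ D N b (10 ℕ.+ q) * c (10 ℕ.+ q)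
    tail-term b q with even-or-odd q
    ... | j , inj₁ refl = subst (λ p → pow2 (m ℕ.+ 6) ∣ D N b p * c p) (sym (index j))
                                (subst (pow2 (m ℕ.+ 6) ∣_) (sym vanishes) (∣0 _))
      where
      index : ∀ j → 10 ℕ.+ 2 ℕ.* j ≡ 2 ℕ.* suc (4 ℕ.+ j)
      index = ℕSolver.solve-∀
      vanishes : D N b (2 ℕ.* suc (4 ℕ.+ j)) * c (2 ℕ.* suc (4 ℕ.+ j)) ≡ + 0
      vanishes = trans (cong (D N b (2 ℕ.* suc (4 ℕ.+ j)) *_) (c-even (4 ℕ.+ j))) (ℤP.*-zeroʳ (D N b (2 ℕ.* suc (4 ℕ.+ j))))
    ... | j , inj₂ refl = subst (λ p → pow2 (m ℕ.+ 6) ∣ D N b p * c p) (sym (index j)) (odd j)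
      where
      index : ∀ j → 10 ℕ.+ suc (2 ℕ.* j) ≡ suc (2 ℕ.* (5 ℕ.+ j))
      index = ℕSolver.solve-∀
      -- c 11, c 13, …, c 19 are 691·2^9, -43688·2^9, 3718276·2^9, -204946624·2^10, 28407114368·2^10.
      odd : ∀ j → pow2 (m ℕ.+ 6) ∣ D N b (suc (2 ℕ.* (5 ℕ.+ j))) * c (suc (2 ℕ.* (5 ℕ.+ j)))
      odd 0 = term-div b 11 3 (divides (+ 691) refl) (ℕP.<ᵇ⇒< 11 16 _)
      odd 1 = term-div b 13 3 (divides (- + 43688) refl) (ℕP.<ᵇ⇒< 13 16 _)
      odd 2 = term-div b 15 3 (divides (+ 3718276) refl) (ℕP.<ᵇ⇒< 15 16 _)
      odd 3 = term-div b 17 4 (divides (- + 204946624) refl) (ℕP.<ᵇ⇒< 17 32 _)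
      odd 4 = term-div b 19 4 (divides (+ 28407114368) refl) (ℕP.<ᵇ⇒< 19 32 _)
      odd (suc (suc (suc (suc (suc j))))) =
        term-div b _ (4 ℕ.+ j) (subst (λ e → pow2 e ∣ c (suc (2 ℕ.* (10 ℕ.+ j)))) (shift j) (c-odd-div (10 ℕ.+ j)))
                 (growth j)
        where
        shift : ∀ j → 10 ℕ.+ j ≡ (4 ℕ.+ j) ℕ.+ 6
        shift = ℕSolver.solve-∀

  DivisibleCoeffs : ℕ → Poly → Set
  DivisibleCoeffs s []      = ⊤
  DivisibleCoeffs s (a ∷ p) = True (pow2 s ∣? a) × DivisibleCoeffs (s ℕ.∸ 3) p

  divisible-eval : ∀ s p x → DivisibleCoeffs s p → pow2 3 ∣ x → pow2 s ∣ ⟦ p ⟧ x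
  divisible-eval s []      x _              _   = ∣0 (pow2 s)
  divisible-eval s (a ∷ p) x (a-div , p-div) 8∣x =
    ∣m∣n⇒∣m+n (toWitness a-div)
              (pow2-∣-* 3 (s ℕ.∸ 3) 8∣x (divisible-eval (s ℕ.∸ 3) p x p-div 8∣x) (ℕP.m≤n+m∸n s 3))

  Certified : Poly → Set
  Certified []      = ⊤
  Certified (a ∷ p) = True (a ℤ.≟ + 0) × DivisibleCoeffs 13 p

  certified-div : ∀ M p x → Certified p → pow2 M ∣ x → 3 ℕ.≤ M → pow2 (M ℕ.+ 13) ∣ ⟦ p ⟧ x
  certified-div M []      x _              _     _   = ∣0 (pow2 (M ℕ.+ 13))
  certified-div M (a ∷ p) x (a≡0 , p-div) 2^M∣x 3≤M =
    ∣m∣n⇒∣m+n (subst (pow2 (M ℕ.+ 13) ∣_) (sym (toWitness a≡0)) (∣0 _))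
              (pow2-∣-* M 13 2^M∣x (divisible-eval 13 p x p-div (∣-trans (pow2-mono 3≤M) 2^M∣x)) ℕP.≤-refl)

  -- For fixed N, H r b = Σ_{p<10} coeff r p · D N b p + correction r N b,
  -- where coeff 0 lists c 1, …, c 9 and coeff (r+1) is obtained from coeff r by the
  -- transformation that Pascal's rule induces on the head sum when b increases by 2.
  c-head : ℕ → ℤ
  c-head 1 = - + 1
  c-head 3 = + 2
  c-head 5 = - + 16
  c-head 7 = + 272
  c-head 9 = - + 7936
  c-head _ = + 0

  coeff : ℕ → ℕ → ℤ
  coeff zero    p       = c-head p
  coeff (suc r) zero    = + 0
  coeff (suc r) (suc p) = + 2 * coeff r (suc (suc p)) + coeff r (suc (suc (suc p)))

  -- The coefficients vanish once r + p ≥ 10, so the window p < 10 is never left.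
  coeff-vanish : ∀ r p → 10 ℕ.≤ r ℕ.+ p → coeff r p ≡ + 0
  coeff-vanish zero    p       10≤p = subst (λ p → c-head p ≡ + 0) (ℕP.m+[n∸m]≡n 10≤p) refl
  coeff-vanish (suc r) zero    _    = refl
  coeff-vanish (suc r) (suc p) 10≤r+p =
    cong₂ (λ u v → + 2 * u + v) (coeff-vanish r (2 ℕ.+ p) 10≤r+2+p)
                                 (coeff-vanish r (3 ℕ.+ p) (ℕP.≤-trans 10≤r+2+p (ℕP.+-monoʳ-≤ r (ℕP.n≤1+n (2 ℕ.+ p)))))
    where
    10≤r+2+p : 10 ℕ.≤ r ℕ.+ (2 ℕ.+ p)
    10≤r+2+p = ℕP.≤-trans 10≤r+p (ℕP.≤-reflexive (shift r p))
      where
      shift : ∀ r p → suc r ℕ.+ suc p ≡ r ℕ.+ (2 ℕ.+ p)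
      shift = ℕSolver.solve-∀

  -- The correction term N((b+1)² + 10 + N(b+1)) of the theorem (r = 0) and the terms
  -- generated from it by the step b ↦ b + 2.
  correction : ℕ → ℤ → ℤ → ℤ
  correction 0 n b = n * ((b + + 1) * (b + + 1) + + 10 + n * (b + + 1))
  correction 1 n b = n * (+ 4 * b + + 8 + + 2 * n)
  correction 2 n b = + 8 * n
  correction _ _ _ = + 0

  correction-step : ∀ r n b → correction r n (+ 2 + b) ≡ correction r n b + correction (suc r) n b
  correction-step 0 n b = expand n b
    where
    expand : ∀ n b → n * ((+ 2 + b + + 1) * (+ 2 + b + + 1) + + 10 + n * (+ 2 + b + + 1))
                   ≡ n * ((b + + 1) * (b + + 1) + + 10 + n * (b + + 1)) + n * (+ 4 * b + + 8 + + 2 * n)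
    expand = solve-∀
  correction-step 1 n b = expand n b
    where
    expand : ∀ n b → n * (+ 4 * (+ 2 + b) + + 8 + + 2 * n) ≡ n * (+ 4 * b + + 8 + + 2 * n) + + 8 * n
    expand = solve-∀
  correction-step 2 n b = sym (ℤP.+-identityʳ (+ 8 * n))
  correction-step (suc (suc (suc r))) n b = refl

  -- Integer polynomials in N whose values at N are p!·D N 0 p, the correction term at
  -- b = 0, and 9!·H r 0.  The cofactor 9!/p! makes all denominators disappear.
  cofactor : ℕ → ℕ
  cofactor p = ((9 !) ℕ./ (p !)) {{p ℕP.!≢0}}

  cofactor-correct : ∀ p → p ℕ.≤ 9 → + cofactor p * + (p !) ≡ + (9 !)
  cofactor-correct p p≤9 =
    trans (sym (ℤP.pos-* (cofactor p) (p !))) (cong +_ (m/n*n≡m {{p ℕP.!≢0}} (m≤n⇒m!∣n! p≤9)))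

  Dpoly : ℕ → Poly
  Dpoly p = falling p +ₚ (- + (p ! ℕ.* bin 0 p) ∷ [])

  correctionPoly : ℕ → Poly
  correctionPoly 0 = + 0 ∷ + 11 ∷ + 1 ∷ []
  correctionPoly 1 = + 0 ∷ + 8 ∷ + 2 ∷ []
  correctionPoly 2 = + 0 ∷ + 8 ∷ []
  correctionPoly _ = []

  correctionPoly-correct : ∀ r x → ⟦ correctionPoly r ⟧ x ≡ correction r x (+ 0)
  correctionPoly-correct 0 = expand
    where
    expand : ∀ x → + 0 + x * (+ 11 + x * (+ 1 + x * + 0)) ≡ x * ((+ 0 + + 1) * (+ 0 + + 1) + + 10 + x * (+ 0 + + 1))
    expand = solve-∀
  correctionPoly-correct 1 = expand
    where
    expand : ∀ x → + 0 + x * (+ 8 + x * (+ 2 + x * + 0)) ≡ x * (+ 4 * + 0 + + 8 + + 2 * x)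
    expand = solve-∀
  correctionPoly-correct 2 = expand
    where
    expand : ∀ x → + 0 + x * (+ 8 + x * + 0) ≡ + 8 * x
    expand = solve-∀
  correctionPoly-correct (suc (suc (suc r))) x = refl

  headPoly : ℕ → Poly
  headPoly r = sumₚ (λ p → (coeff r p * + cofactor p) ·ₚ Dpoly p) 10 +ₚ + (9 !) ·ₚ correctionPoly r

  headPoly-certified : (r : Fin 9) → Certified (headPoly (toℕ r))
  headPoly-certified 0F = _
  headPoly-certified 1F = _
  headPoly-certified 2F = _
  headPoly-certified 3F = _
  headPoly-certified 4F = _
  headPoly-certified 5F = _
  headPoly-certified 6F = _
  headPoly-certified 7F = _
  headPoly-certified 8F = _

  module Head (N : ℕ) where

    headSum : (ℕ → ℤ) → ℕ → ℤ
    headSum a b = sumℤ (λ p → a p * D N b p) 10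

    -- Pascal's rule moves one step in b to a shift of the coefficients.
    headSum-step : ∀ (a : ℕ → ℤ) b → a 10 ≡ + 0 → headSum a (suc b) ≡ headSum a b + headSum (λ p → a (suc p)) b
    headSum-step a b a10≡0 = begin
      headSum a (suc b)
        ≡⟨ sum-shift (λ p → a p * D N (suc b) p) 9 ⟩
      a 0 * D N (suc b) 0 + sumℤ (λ q → a (suc q) * D N (suc b) (suc q)) 9
        ≡⟨ cong₂ _+_ (first-vanishes (suc b)) (trans (sum-cong 9 (λ q _ → pascal q)) (sum-+ G₁ G₂ 9)) ⟩
      + 0 + (sumℤ G₁ 9 + sumℤ G₂ 9)
        ≡⟨ swap (sumℤ G₁ 9) (sumℤ G₂ 9) ⟩
      (+ 0 + sumℤ G₂ 9) + (sumℤ G₁ 9 + + 0)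
        ≡⟨ cong₂ _+_ (trans (cong (_+ sumℤ G₂ 9) (sym (first-vanishes b))) (sym (sum-shift (λ p → a p * D N b p) 9)))
                     (cong (_+_ (sumℤ G₁ 9)) (sym (trans (cong (_* D N b 9) a10≡0) (ℤP.*-zeroˡ (D N b 9))))) ⟩
      headSum a b + headSum (λ p → a (suc p)) b ∎
      where
      G₁ G₂ : ℕ → ℤ
      G₁ q = a (suc q) * D N b q
      G₂ q = a (suc q) * D N b (suc q)
      first-vanishes : ∀ b → a 0 * D N b 0 ≡ + 0
      first-vanishes b = trans (cong (a 0 *_) (D-zero N b)) (ℤP.*-zeroʳ (a 0))
      pascal : ∀ q → a (suc q) * D N (suc b) (suc q) ≡ G₁ q + G₂ q
      pascal q = trans (cong (a (suc q) *_) (D-suc N b q)) (ℤP.*-distribˡ-+ (a (suc q)) (D N b q) (D N b (suc q)))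
      swap : ∀ s t → + 0 + (s + t) ≡ (+ 0 + t) + (s + + 0)
      swap = solve-∀

    headSum-linear : ∀ (a a′ : ℕ → ℤ) b → headSum (λ p → + 2 * a p + a′ p) b ≡ + 2 * headSum a b + headSum a′ b
    headSum-linear a a′ b = trans (sum-cong 10 (λ p _ → distribute (a p) (a′ p) (D N b p)))
      (trans (sum-+ (λ p → + 2 * (a p * D N b p)) (λ p → a′ p * D N b p) 10)
             (cong (_+ headSum a′ b) (sum-* (+ 2) (λ p → a p * D N b p) 10)))
      where
      distribute : ∀ x y d → (+ 2 * x + y) * d ≡ + 2 * (x * d) + y * d
      distribute = solve-∀

    headSum-cong⁺ : ∀ (a a′ : ℕ → ℤ) b → (∀ p → p ℕ.< 9 → a (suc p) ≡ a′ (suc p)) →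
                    headSum a b ≡ headSum a′ b
    headSum-cong⁺ a a′ b a≡a′ = sum-cong 10 same
      where
      same : ∀ p → p ℕ.< 10 → a p * D N b p ≡ a′ p * D N b p
      same zero    _          = trans (cong (a 0 *_) (D-zero N b))
                                      (trans (ℤP.*-zeroʳ (a 0)) (sym (trans (cong (a′ 0 *_) (D-zero N b)) (ℤP.*-zeroʳ (a′ 0)))))
      same (suc p) (s≤s p<9) = cong (_* D N b (suc p)) (a≡a′ p p<9)

    -- Two steps in b: by construction coeff (r+1) is the induced transformation of coeff r.
    headSum-step2 : ∀ r b → headSum (coeff r) (2 ℕ.+ b) ≡ headSum (coeff r) b + headSum (coeff (suc r)) b
    headSum-step2 r b = begin
      headSum (coeff r) (2 ℕ.+ b)
        ≡⟨ headSum-step (coeff r) (suc b) (coeff-vanish r 10 (ℕP.m≤n+m 10 r)) ⟩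
      headSum (coeff r) (suc b) + headSum S (suc b)
        ≡⟨ cong₂ _+_ (headSum-step (coeff r) b (coeff-vanish r 10 (ℕP.m≤n+m 10 r)))
                     (headSum-step S b (coeff-vanish r 11 (ℕP.≤-trans (ℕP.n≤1+n 10) (ℕP.m≤n+m 11 r)))) ⟩
      (headSum (coeff r) b + headSum S b) + (headSum S b + headSum SS b)
        ≡⟨ collect (headSum (coeff r) b) (headSum S b) (headSum SS b) ⟩
      headSum (coeff r) b + (+ 2 * headSum S b + headSum SS b)
        ≡⟨ cong (_+_ (headSum (coeff r) b)) (sym (headSum-linear S SS b)) ⟩
      headSum (coeff r) b + headSum (λ p → + 2 * S p + SS p) b
        ≡⟨ cong (_+_ (headSum (coeff r) b)) (headSum-cong⁺ (λ p → + 2 * S p + SS p) (coeff (suc r)) b (λ p _ → refl)) ⟩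
      headSum (coeff r) b + headSum (coeff (suc r)) b ∎
      where
      S SS : ℕ → ℤ
      S  p = coeff r (suc p)
      SS p = coeff r (suc (suc p))
      collect : ∀ x s t → (x + s) + (s + t) ≡ x + (+ 2 * s + t)
      collect = solve-∀

    H : ℕ → ℕ → ℤ
    H r b = headSum (coeff r) b + correction r (+ N) (+ b)

    H-step : ∀ r b → H r (2 ℕ.+ b) ≡ H r b + H (suc r) b
    H-step r b = trans (cong₂ _+_ (headSum-step2 r b) (correction-step r (+ N) (+ b)))
                       (interchange (headSum (coeff r) b) _ _ _)
      where
      interchange : ∀ a b c d → (a + b) + (c + d) ≡ (a + c) + (b + d)
      interchange = solve-∀

    H-vanish : ∀ r b → H (9 ℕ.+ r) b ≡ + 0
    H-vanish r b = trans (ℤP.+-identityʳ _)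
      (sum-zero _ 10 (λ p _ → trans (cong (_* D N b p) (coeff-late p)) (ℤP.*-zeroˡ (D N b p))))
      where
      coeff-late : ∀ p → coeff (9 ℕ.+ r) p ≡ + 0
      coeff-late zero    = refl
      coeff-late (suc p) =
        coeff-vanish (9 ℕ.+ r) (suc p) (ℕP.≤-trans (s≤s (ℕP.m≤m+n 9 (r ℕ.+ p))) (ℕP.≤-reflexive (shift r p)))
        where
        shift : ∀ r p → suc (9 ℕ.+ (r ℕ.+ p)) ≡ (9 ℕ.+ r) ℕ.+ suc p
        shift = ℕSolver.solve-∀

    Dpoly-correct : ∀ p → ⟦ Dpoly p ⟧ (+ N) ≡ + (p !) * D N 0 p
    Dpoly-correct p = begin
      ⟦ falling p +ₚ (- + (p ! ℕ.* bin 0 p) ∷ []) ⟧ (+ N)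
        ≡⟨ +ₚ-correct (falling p) _ (+ N) ⟩
      ⟦ falling p ⟧ (+ N) + (- + (p ! ℕ.* bin 0 p) + + N * + 0)
        ≡⟨ cong₂ (λ u v → u + (- v + + N * + 0)) (falling-bin p N) (ℤP.pos-* (p !) (bin 0 p)) ⟩
      + (p !) * + bin N p + (- (+ (p !) * + bin 0 p) + + N * + 0)
        ≡⟨ factor (+ (p !)) (+ bin N p) (+ bin 0 p) (+ N) ⟩
      + (p !) * (+ bin N p - + bin 0 p)
        ≡⟨ cong (λ z → + (p !) * (+ bin z p - + bin 0 p)) (sym (ℕP.+-identityʳ N)) ⟩
      + (p !) * D N 0 p ∎
      where
      factor : ∀ f x y n → f * x + (- (f * y) + n * + 0) ≡ f * (x - y)
      factor = solve-∀

    headPoly-correct : ∀ r → ⟦ headPoly r ⟧ (+ N) ≡ + (9 !) * H r 0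
    headPoly-correct r = begin
      ⟦ headPoly r ⟧ (+ N)
        ≡⟨ +ₚ-correct (sumₚ term 10) (+ (9 !) ·ₚ correctionPoly r) (+ N) ⟩
      ⟦ sumₚ term 10 ⟧ (+ N) + ⟦ + (9 !) ·ₚ correctionPoly r ⟧ (+ N)
        ≡⟨ cong₂ _+_ (trans (sumₚ-correct term 10 (+ N)) (sum-cong 10 (λ p p<10 → term-correct p (ℕP.≤-pred p<10))))
                     (trans (·ₚ-correct (+ (9 !)) (correctionPoly r) (+ N)) (cong (+ (9 !) *_) (correctionPoly-correct r (+ N)))) ⟩
      sumℤ (λ p → + (9 !) * (coeff r p * D N 0 p)) 10 + + (9 !) * correction r (+ N) (+ 0)
        ≡⟨ cong (_+ + (9 !) * correction r (+ N) (+ 0)) (sum-* (+ (9 !)) (λ p → coeff r p * D N 0 p) 10) ⟩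
      + (9 !) * headSum (coeff r) 0 + + (9 !) * correction r (+ N) (+ 0)
        ≡⟨ sym (ℤP.*-distribˡ-+ (+ (9 !)) (headSum (coeff r) 0) (correction r (+ N) (+ 0))) ⟩
      + (9 !) * H r 0 ∎
      where
      term : ℕ → Poly
      term p = (coeff r p * + cofactor p) ·ₚ Dpoly p
      term-correct : ∀ p → p ℕ.≤ 9 → ⟦ term p ⟧ (+ N) ≡ + (9 !) * (coeff r p * D N 0 p)
      term-correct p p≤9 = begin
        ⟦ term p ⟧ (+ N)
          ≡⟨ trans (·ₚ-correct (coeff r p * + cofactor p) (Dpoly p) (+ N))
                   (cong ((coeff r p * + cofactor p) *_) (Dpoly-correct p)) ⟩
        (coeff r p * + cofactor p) * (+ (p !) * D N 0 p)
          ≡⟨ regroup (coeff r p) (+ cofactor p) (+ (p !)) (D N 0 p) ⟩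
        (+ cofactor p * + (p !)) * (coeff r p * D N 0 p)
          ≡⟨ cong (_* (coeff r p * D N 0 p)) (cofactor-correct p p≤9) ⟩
        + (9 !) * (coeff r p * D N 0 p) ∎
        where
        regroup : ∀ a k f d → (a * k) * (f * d) ≡ (k * f) * (a * d)
        regroup = solve-∀

  module HeadDivisibility (M N : ℕ) (3≤M : 3 ℕ.≤ M) (2^M∣N : pow2 M ∣ + N) where
    open Head N

    -- b = 0: 2^(M+13) ∣ 9!·H r 0 = 2^7·2835·H r 0 by the certificate, and 2835 is odd.
    H-base : ∀ r → pow2 (M ℕ.+ 6) ∣ H r 0
    H-base r with r ℕP.<? 9
    ... | yes r<9 = odd-cancel (M ℕ.+ 6) (+ 1417) (H r 0) (*-cancelˡ-∣ (pow2 7) (subst₂ _∣_ split-power split-factorial poly-div))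
      where
      certificate : Certified (headPoly r)
      certificate = subst (λ r → Certified (headPoly r)) (toℕ-fromℕ< r<9) (headPoly-certified (fromℕ< r<9))
      poly-div : pow2 (M ℕ.+ 13) ∣ + (9 !) * H r 0
      poly-div = subst (pow2 (M ℕ.+ 13) ∣_) (headPoly-correct r) (certified-div M (headPoly r) (+ N) certificate 2^M∣N 3≤M)
      split-power : pow2 (M ℕ.+ 13) ≡ pow2 7 * pow2 (M ℕ.+ 6)
      split-power = trans (cong pow2 (shift M)) (pow2-+ 7 (M ℕ.+ 6))
        where
        shift : ∀ M → M ℕ.+ 13 ≡ 7 ℕ.+ (M ℕ.+ 6)
        shift = ℕSolver.solve-∀
      split-factorial : + (9 !) * H r 0 ≡ pow2 7 * ((+ 1 + + 2 * + 1417) * H r 0)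
      split-factorial = ℤP.*-assoc (pow2 7) (+ 1 + + 2 * + 1417) (H r 0)
    ... | no r≮9 = subst (pow2 (M ℕ.+ 6) ∣_) (sym vanishes) (∣0 _)
      where
      vanishes : H r 0 ≡ + 0
      vanishes = trans (cong (λ s → H s 0) (sym (ℕP.m+[n∸m]≡n (ℕP.≮⇒≥ r≮9)))) (H-vanish (r ℕ.∸ 9) 0)

    H-div : ∀ y r → pow2 (M ℕ.+ 6) ∣ H r (2 ℕ.* y)
    H-div zero    r = H-base r
    H-div (suc y) r = subst (λ b → pow2 (M ℕ.+ 6) ∣ H r b) (sym (ℕP.*-suc 2 y))
      (subst (pow2 (M ℕ.+ 6) ∣_) (sym (H-step r (2 ℕ.* y))) (∣m∣n⇒∣m+n (H-div y r) (H-div y (suc r))))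

  c-head-correct : (p : Fin 9) → c (suc (toℕ p)) ≡ c-head (suc (toℕ p))
  c-head-correct 0F = refl
  c-head-correct 1F = refl
  c-head-correct 2F = refl
  c-head-correct 3F = refl
  c-head-correct 4F = refl
  c-head-correct 5F = refl
  c-head-correct 6F = refl
  c-head-correct 7F = refl
  c-head-correct 8F = refl

  head-sum : ∀ N b → sumℤ (λ q → D N b q * c q) 10 ≡ Head.headSum N (coeff 0) b
  head-sum N b = trans (sum-cong 10 (λ q _ → ℤP.*-comm (D N b q) (c q)))
                       (Head.headSum-cong⁺ N c (coeff 0) b agree)
    where
    agree : ∀ p → p ℕ.< 9 → c (suc p) ≡ c-head (suc p)
    agree p p<9 = subst (λ p → c (suc p) ≡ c-head (suc p)) (toℕ-fromℕ< p<9) (c-head-correct (fromℕ< p<9))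

  newton-difference : ∀ N b → E (N ℕ.+ b) - E b ≡
    sumℤ (λ q → D N b q * c q) 10 + sumℤ (λ q → D N b (10 ℕ.+ q) * c (10 ℕ.+ q)) (suc (N ℕ.+ b))
  newton-difference N b = begin
    E (N ℕ.+ b) - E b
      ≡⟨ cong₂ _-_ (trans (E-newton (N ℕ.+ b) 10) (cong (sumℤ f) (ℕP.+-comm (suc (N ℕ.+ b)) 10)))
                   (trans (E-newton b (N ℕ.+ 10)) (cong (sumℤ g) (length-identity b N))) ⟩
    sumℤ f U - sumℤ g U
      ≡⟨ sym (sum-sub f g U) ⟩
    sumℤ (λ q → f q - g q) U
      ≡⟨ sum-cong U (λ q _ → factor (+ bin (N ℕ.+ b) q) (+ bin b q) (c q)) ⟩
    sumℤ (λ q → D N b q * c q) U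
      ≡⟨ sum-split (λ q → D N b q * c q) 10 (suc (N ℕ.+ b)) ⟩
    sumℤ (λ q → D N b q * c q) 10 + sumℤ (λ q → D N b (10 ℕ.+ q) * c (10 ℕ.+ q)) (suc (N ℕ.+ b)) ∎
    where
    U = 10 ℕ.+ suc (N ℕ.+ b)
    f g : ℕ → ℤ
    f q = + bin (N ℕ.+ b) q * c q
    g q = + bin b q * c q
    length-identity : ∀ b N → suc b ℕ.+ (N ℕ.+ 10) ≡ 10 ℕ.+ suc (N ℕ.+ b)
    length-identity = ℕSolver.solve-∀
    factor : ∀ x y z → x * z - y * z ≡ (x - y) * z
    factor = solve-∀

  euler-congruence : ∀ M N b′ → 3 ℕ.≤ M → pow2 M ∣ + N →
    let b = 2 ℕ.* b′ in
    pow2 (M ℕ.+ 6) ∣ E (N ℕ.+ b) - (E b - + N * (+ (b ℕ.+ 1) * + (b ℕ.+ 1) + + 10 + + N * + (b ℕ.+ 1)))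
  euler-congruence M N b′ 3≤M 2^M∣N =
    subst (pow2 (M ℕ.+ 6) ∣_) (sym decomposition)
          (∣m∣n⇒∣m+n (sum-div _ _ (suc (N ℕ.+ b)) (λ q _ → Tail.tail-term M N 2^M∣N b q))
                     (HeadDivisibility.H-div M N 3≤M 2^M∣N b′ 0))
    where
    b = 2 ℕ.* b′
    tail = sumℤ (λ q → D N b (10 ℕ.+ q) * c (10 ℕ.+ q)) (suc (N ℕ.+ b))
    decomposition : E (N ℕ.+ b) - (E b - correction 0 (+ N) (+ b)) ≡ tail + Head.H N 0 b
    decomposition = begin
      E (N ℕ.+ b) - (E b - correction 0 (+ N) (+ b))
        ≡⟨ unfold-difference (E (N ℕ.+ b)) (E b) (correction 0 (+ N) (+ b)) ⟩
      (E (N ℕ.+ b) - E b) + correction 0 (+ N) (+ b)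
        ≡⟨ cong (_+ correction 0 (+ N) (+ b)) (trans (newton-difference N b) (cong (_+ tail) (head-sum N b))) ⟩
      (Head.headSum N (coeff 0) b + tail) + correction 0 (+ N) (+ b)
        ≡⟨ regroup (Head.headSum N (coeff 0) b) tail (correction 0 (+ N) (+ b)) ⟩
      tail + Head.H N 0 b ∎
      where
      unfold-difference : ∀ a e w → a - (e - w) ≡ (a - e) + w
      unfold-difference = solve-∀
      regroup : ∀ h t w → (h + t) + w ≡ t + (h + w)
      regroup = solve-∀

  pow2-∣⇒∣ᵤ : ∀ e {x} → pow2 e ∣ x → + (2 ℕ.^ e) Unsigned.∣ x
  pow2-∣⇒∣ᵤ e {x} 2^e∣x = ∣⇒∣ᵤ (subst (_∣ x) (sym (pos-pow2 e)) 2^e∣x)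

  pow2-multiple : ∀ m k → pow2 m ∣ + (2 ℕ.^ m ℕ.* k)
  pow2-multiple m k =
    subst₂ _∣_ (pos-pow2 m) (sym (ℤP.pos-* (2 ℕ.^ m) k)) (∣m⇒∣m*n (+ k) ∣-refl)

open import Defs
open import Data.Nat as ℕ using (ℕ; _≥_; _^_; NonZero)
open import Data.Integer as ℤ using (ℤ; +_; _-_; _+_; _*_)
open import Data.Integer.Divisibility using (_∣_)
open EulerCongruence using (euler-congruence; pow2-multiple; pow2-∣⇒∣ᵤ)

corollary2p2 : (b' k m : ℕ) → .{{_ : NonZero k}} → m ≥ 3 →
    let b = 2 ℕ.* b'
        N = (2 ^ m) ℕ.* k
    in (+ (2 ^ (m ℕ.+ 6))) ∣
         (E (N ℕ.+ b) - (E b - (+ N) * ((+ (b ℕ.+ 1)) * (+ (b ℕ.+ 1)) + + 10 + (+ N) * (+ (b ℕ.+ 1)))))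
corollary2p2 b' k m m≥3 =
  pow2-∣⇒∣ᵤ (m ℕ.+ 6) (euler-congruence m (2 ^ m ℕ.* k) b' m≥3 (pow2-multiple m k))
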